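{- Let $S=\{R_0,\dots,R_d\}$ be an association scheme and let $T$ be a closed subset of $S$. Then $T$ is a singular subset of $S$ if and only if $O^\vartheta(S)\cup O_\vartheta(S)\subseteq T$.
   Context: $S$ is an association scheme on a finite set $X$ with relations $R_0$ (diagonal), $R_1,\dots,R_d$, transposes $R_{i^*}$, intersection numbers $p_{ij}^k$ and valencies $k_i=p_{ii^*}^0$. For nonempty $U,V\subseteq S$, $UV=\{R_k:\exists R_u\in U,R_v\in V,\ p_{uv}^k>0\}$ (associative; $R_i$ stands for $\{R_i\}$). $T\subseteq S$ nonempty is closed if $T^*T\subseteq T$, $T^*=\{R_{i^*}:R_i\in T\}$; strongly normal if also $R_{i^*}TR_i\subseteq T$ for all $i$. $O_\vartheta(S)=\{R_i:k_i=1\}$; $O^\vartheta(S)$ is the intersection of all strongly normal closed subsets. A subset $T\subseteq S$ is singular if (i) $O_\vartheta(S)\subseteq T$ and (ii) $R_xR_{y^*}R_yR_z\subseteq T$ for all $R_x\in O_\vartheta(S)$, $R_y\in S$, $R_z\in T$. -}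

module Defs where

open import Data.Nat using (ℕ; suc; _<_)
open import Data.Fin using (Fin; zero; _≟_)
open import Data.Fin.Subset using (Subset; _∈_)
open import Data.List using (length; filter)
open import Data.List.Base using (allFin)
open import Data.Product using (Σ; ∃; ∃₂; _×_; _,_)
open import Data.Sum using (_⊎_)
open import Relation.Nullary.Decidable using (_×-dec_)
open import Relation.Binary.PropositionalEquality using (_≡_)
open import Function.Bundles using (_⇔_)

countMid : {n d : ℕ} → (Fin n → Fin n → Fin (suc d)) →
           Fin n → Fin n → Fin (suc d) → Fin (suc d) → ℕ
countMid {n} rel x y i j =
  length (filter (λ z → (rel x z ≟ i) ×-dec (rel z y ≟ j)) (allFin n))

-- An association scheme S = {R_0,…,R_d} on the finite set X = Fin n.
-- Relation R_i = {(x,y) | rel x y ≡ i}; these partition X × X.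
record Scheme (n d : ℕ) : Set where
  field
    rel          : Fin n → Fin n → Fin (suc d)
    nonempty     : ∀ i → ∃₂ λ x y → rel x y ≡ i
    diagonal     : ∀ x y → (rel x y ≡ zero) ⇔ (x ≡ y)
    _*           : Fin (suc d) → Fin (suc d)
    transpose    : ∀ x y → rel y x ≡ (rel x y) *
    p            : Fin (suc d) → Fin (suc d) → Fin (suc d) → ℕ
    intersection : ∀ i j x y → countMid rel x y i j ≡ p i j (rel x y)

module _ {n d : ℕ} (S : Scheme n d) where
  open Scheme S

  Idx : Set
  Idx = Fin (suc d)

  PSet : Set₁
  PSet = Idx → Set

  ⟦_⟧ : Subset (suc d) → PSet
  ⟦ T ⟧ k = k ∈ T

  ｛_｝ : Idx → PSet
  ｛ i ｝ k = k ≡ i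

  _·_ : PSet → PSet → PSet
  (U · V) k = ∃₂ λ u v → U u × V v × 0 < p u v k

  _⊆ₚ_ : PSet → PSet → Set
  U ⊆ₚ V = ∀ k → U k → V k

  star : PSet → PSet
  star T k = ∃ λ i → T i × k ≡ i *

  valency : Idx → ℕ
  valency i = p i (i *) zero

  Nonempty : PSet → Set
  Nonempty T = ∃ λ i → T i

  Closed : Subset (suc d) → Set
  Closed T = Nonempty ⟦ T ⟧ × ((star ⟦ T ⟧ · ⟦ T ⟧) ⊆ₚ ⟦ T ⟧)

  StronglyNormalClosed : Subset (suc d) → Set
  StronglyNormalClosed T =
    Closed T × (∀ i → ((｛ i * ｝ · ⟦ T ⟧) · ｛ i ｝) ⊆ₚ ⟦ T ⟧)

  Othin : PSet
  Othin i = valency i ≡ 1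

  Oup : PSet
  Oup k = ∀ (U : Subset (suc d)) → StronglyNormalClosed U → k ∈ U

  Singular : Subset (suc d) → Set
  Singular T =
    (Othin ⊆ₚ ⟦ T ⟧) ×
    (∀ x y z → Othin x → z ∈ T →
       (((｛ x ｝ · ｛ y * ｝) · ｛ y ｝) · ｛ z ｝) ⊆ₚ ⟦ T ⟧)

-- If T is closed and singular, the R_k with R_{j*} R_k R_j ⊆ T for all j form a strongly
-- normal closed subset contained in T: closedness comes from that of T, strong normality
-- from R_{y*} R_y T ⊆ T, which is singularity for R_x = R_0.  Hence O^ϑ(S) ⊆ T.
-- Conversely R_{y*} R_y ⊆ R_{y*} U R_y ⊆ U for every strongly normal closed U, so
-- R_x R_{y*} R_y R_z ⊆ O_ϑ(S) O^ϑ(S) T ⊆ T.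
module Submission where

open import Defs
open import Data.Nat using (ℕ; suc; _<_)
open import Data.Fin.Subset using (Subset; _∈_)
open import Data.Sum using (_⊎_; inj₁; inj₂)
open import Function.Bundles using (_⇔_; mk⇔; Equivalence)

open import Data.Fin using (Fin; zero; suc; _≟_)
open import Data.Fin.Properties using (all?; 0≢1+n; suc-injective)
open import Data.Fin.Subset.Properties using (_∈?_)
open import Data.List using ([]; _∷_; length; filter; tabulate; allFin)
open import Data.List.Properties using (filter-accept; filter-reject; filter-none; filter-some)
open import Data.List.Membership.Propositional using () renaming (_∈_ to _∈ₗ_)
open import Data.List.Membership.Propositional.Properties using (∈-filter⁻)
open import Data.List.Relation.Unary.Any using (here)
import Data.List.Relation.Unary.All.Properties as All
import Data.List.Relation.Unary.Any.Properties as Any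
open import Data.Product using (∃; _×_; _,_; proj₁; proj₂)
import Data.Vec as Vec
open import Data.Vec.Properties using (lookup∘tabulate; []=⇒lookup; lookup⇒[]=)
open import Function using (id; _∘_)
open import Level using (Level)
open import Relation.Nullary using (does; yes; no)
open import Relation.Nullary.Decidable using (dec-true; _×-dec_; _→-dec_)
open import Relation.Unary using (Pred; Decidable)
open import Relation.Binary.PropositionalEquality
  using (_≡_; refl; sym; trans; cong; subst; module ≡-Reasoning)

private
  variable
    a ℓ : Level
    A : Set a

module _ {P : Pred A ℓ} (P? : Decidable P) where

  0<length-filter⇒∃ : ∀ xs → 0 < length (filter P? xs) → ∃ P
  0<length-filter⇒∃ xs h with filter P? xs in eq
  0<length-filter⇒∃ xs () | []
  ... | y ∷ _ = y , proj₂ (∈-filter⁻ P? {xs = xs} (subst (y ∈ₗ_) (sym eq) (here refl)))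

  length-filter-tabulate-unique : ∀ {m} (g : Fin m → A) {i : Fin m} →
    P (g i) → (∀ j → P (g j) → j ≡ i) → length (filter P? (tabulate g)) ≡ 1
  length-filter-tabulate-unique g {zero} Pgi unique =
    trans (cong length (filter-accept P? Pgi))
          (cong (suc ∘ length) (filter-none P? (All.tabulate⁺ λ j → 0≢1+n ∘ sym ∘ unique (suc j))))
  length-filter-tabulate-unique g {suc i} Pgi unique =
    trans (cong length (filter-reject P? (0≢1+n ∘ unique zero)))
          (length-filter-tabulate-unique (g ∘ suc) Pgi λ j → suc-injective ∘ unique (suc j))

module _ {m : ℕ} {P : Pred (Fin m) ℓ} (P? : Decidable P) where

  subset : Subset m
  subset = Vec.tabulate (does ∘ P?)

  ∈-subset⁺ : ∀ {i} → P i → i ∈ subset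
  ∈-subset⁺ {i} Pi = lookup⇒[]= i subset (trans (lookup∘tabulate (does ∘ P?) i) (dec-true (P? i) Pi))

  ∈-subset⁻ : ∀ {i} → i ∈ subset → P i
  ∈-subset⁻ {i} i∈ with P? i | trans (sym (lookup∘tabulate (does ∘ P?) i)) ([]=⇒lookup i∈)
  ... | yes Pi | _  = Pi
  ... | no _   | ()

module _ {n d : ℕ} (S : Scheme n d) where
  open Scheme S
  open ≡-Reasoning

  rel-refl : ∀ x → rel x x ≡ zero
  rel-refl x = Equivalence.from (diagonal x x) refl

  *-involutive : ∀ i → i * * ≡ i
  *-involutive i with x , y , refl ← nonempty i = begin
    rel x y * * ≡⟨ cong _* (transpose x y) ⟨
    rel y x *   ≡⟨ transpose y x ⟨
    rel x y     ∎

  zero*≡zero : zero * ≡ zero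
  zero*≡zero with x , _ ← nonempty zero = begin
    zero *      ≡⟨ cong _* (rel-refl x) ⟨
    rel x x *   ≡⟨ transpose x x ⟨
    rel x x     ≡⟨ rel-refl x ⟩
    zero        ∎

  valency-zero : Othin S zero
  valency-zero with x , _ ← nonempty zero = begin
    p zero (zero *) zero        ≡⟨ cong (λ k → p zero k zero) zero*≡zero ⟩
    p zero zero zero            ≡⟨ cong (p zero zero) (rel-refl x) ⟨
    p zero zero (rel x x)       ≡⟨ intersection zero zero x x ⟨
    countMid rel x x zero zero  ≡⟨ length-filter-tabulate-unique (λ z → (rel x z ≟ zero) ×-dec (rel z x ≟ zero)) id
                                     (rel-refl x , rel-refl x)
                                     (λ z (xz , _) → sym (Equivalence.to (diagonal x z) xz)) ⟩
    1                           ∎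

  path⇒p>0 : ∀ a b c → 0 < p (rel a b) (rel b c) (rel a c)
  path⇒p>0 a b c = subst (0 <_) (intersection (rel a b) (rel b c) a c)
    (filter-some (λ z → (rel a z ≟ rel a b) ×-dec (rel z c ≟ rel b c)) (Any.tabulate⁺ b (refl , refl)))

  p>0⇒path : ∀ {u v a c} → 0 < p u v (rel a c) → ∃ λ b → rel a b ≡ u × rel b c ≡ v
  p>0⇒path {u} {v} {a} {c} h = 0<length-filter⇒∃ (λ z → (rel a z ≟ u) ×-dec (rel z c ≟ v)) (allFin n)
    (subst (0 <_) (sym (intersection u v a c)) h)

  ·-intro : ∀ {U V : PSet S} {a b c} → U (rel a b) → V (rel b c) → _·_ S U V (rel a c)
  ·-intro {a = a} {b} {c} Uab Vbc = rel a b , rel b c , Uab , Vbc , path⇒p>0 a b c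

  ·-elim : ∀ {U V : PSet S} {a c} → _·_ S U V (rel a c) → ∃ λ b → U (rel a b) × V (rel b c)
  ·-elim (u , v , Uu , Vv , p>0) with b , refl , refl ← p>0⇒path p>0 = b , Uu , Vv

  ∃-successor : ∀ x i → ∃ λ y → rel x y ≡ i
  ∃-successor x i with a , b , refl ← nonempty i =
    let y , xy , _ = p>0⇒path (subst (λ k → 0 < p (rel a b) (rel b a) k)
                                     (trans (rel-refl a) (sym (rel-refl x))) (path⇒p>0 a b a))
    in y , xy

  star⇒transpose : ∀ {U : PSet S} {a b} → star S U (rel a b) → U (rel b a)
  star⇒transpose {U} {a} {b} (i , Ui , ab≡i*) = subst U (sym (begin
    rel b a     ≡⟨ transpose a b ⟩
    rel a b *   ≡⟨ cong _* ab≡i* ⟩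
    i * *       ≡⟨ *-involutive i ⟩
    i           ∎)) Ui

  transpose-≡ : ∀ {a b c e} → rel a b ≡ rel c e → rel b a ≡ rel e c
  transpose-≡ {a} {b} {c} {e} ab≡ce = begin
    rel b a     ≡⟨ transpose a b ⟩
    rel a b *   ≡⟨ cong _* ab≡ce ⟩
    rel c e *   ≡⟨ transpose c e ⟨
    rel e c     ∎

  module _ {T : Subset (suc d)} (closed : Closed S T) where

    closed-join : ∀ {a b c} → rel b a ∈ T → rel b c ∈ T → rel a c ∈ T
    closed-join {a} {b} {c} ba bc = proj₂ closed (rel a c) (·-intro (rel b a , ba , transpose b a) bc)

    zero∈closed : zero ∈ T
    zero∈closed with i , i∈T ← proj₁ closed with a , b , refl ← nonempty i =
      subst (_∈ T) (rel-refl b) (closed-join i∈T i∈T)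

    rel-refl∈closed : ∀ x → rel x x ∈ T
    rel-refl∈closed x = subst (_∈ T) (sym (rel-refl x)) zero∈closed

    closed-sym : ∀ {a b} → rel a b ∈ T → rel b a ∈ T
    closed-sym {a} ab = closed-join ab (rel-refl∈closed a)

    closed-trans : ∀ {a b c} → rel a b ∈ T → rel b c ∈ T → rel a c ∈ T
    closed-trans ab bc = closed-join (closed-sym ab) bc

  -- The hypothesis `absorb` is R_{y*} R_y T ⊆ T, read along b ← c → d → e with rel c b ≡ rel c d.
  module StronglyNormalCore {T : Subset (suc d)} (closed : Closed S T)
    (absorb : ∀ {b c d e} → rel c b ≡ rel c d → rel d e ∈ T → rel b e ∈ T) where

    -- R_{j*} R_k R_j ⊆ T for every j, read along a ← b → c → e with rel b a ≡ rel c e ≡ j.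
    InCore : Idx S → Set
    InCore k = ∀ a b c e → rel b c ≡ k → rel b a ≡ rel c e → rel a e ∈ T

    InCore? : Decidable InCore
    InCore? k = all? λ a → all? λ b → all? λ c → all? λ e →
      (rel b c ≟ k) →-dec ((rel b a ≟ rel c e) →-dec (rel a e ∈? T))

    core : Subset (suc d)
    core = subset InCore?

    core⊆T : ∀ {k} → k ∈ core → k ∈ T
    core⊆T {k} k∈core with b , c , refl ← nonempty k =
      ∈-subset⁻ InCore? k∈core b b c c refl (trans (rel-refl b) (sym (rel-refl c)))

    zero∈core : zero ∈ core
    zero∈core = ∈-subset⁺ InCore? in-core
      where
        in-core : InCore zero
        in-core a b c e bc≡0 ba≡ce with refl ← Equivalence.to (diagonal b c) bc≡0 =
          absorb ba≡ce (rel-refl∈closed closed e)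

    core-closed : _⊆ₚ_ S (_·_ S (star S (⟦_⟧ S core)) (⟦_⟧ S core)) (⟦_⟧ S core)
    core-closed k k∈ = ∈-subset⁺ InCore? in-core
      where
        in-core : InCore k
        in-core a b c e refl ba≡ce
          with z , bz∈ , zc∈ ← ·-elim k∈
          with w , zw≡ba ← ∃-successor z (rel b a) =
          closed-join closed
            (∈-subset⁻ InCore? (star⇒transpose bz∈) w z b a refl zw≡ba)
            (∈-subset⁻ InCore? zc∈ w z c e refl (trans zw≡ba ba≡ce))

    core-normal : ∀ j → _⊆ₚ_ S (_·_ S (_·_ S (｛_｝ S (j *)) (⟦_⟧ S core)) (｛_｝ S j)) (⟦_⟧ S core)
    core-normal j k k∈ = ∈-subset⁺ InCore? in-core
      where
        in-core : InCore k
        in-core a b c e refl ba≡ce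
          with z , bz∈ , zc≡j ← ·-elim k∈
          with y , by≡j* , yz∈ ← ·-elim bz∈
          with a' , za'≡ya , a'c≡ab ← p>0⇒path (subst (λ r → 0 < p (rel y a) (rel a b) r)
                 (trans (star⇒transpose {｛_｝ S j} (j , refl , by≡j*)) (sym zc≡j)) (path⇒p>0 y a b)) =
          closed-trans closed
            (∈-subset⁻ InCore? yz∈ a y z a' refl (sym za'≡ya))
            (absorb (trans (transpose-≡ a'c≡ab) ba≡ce) (rel-refl∈closed closed e))

    core-stronglyNormalClosed : StronglyNormalClosed S core
    core-stronglyNormalClosed = ((zero , zero∈core) , core-closed) , core-normal

  singular⇒absorb : ∀ {T} → Singular S T →
    ∀ {b c d e} → rel c b ≡ rel c d → rel d e ∈ T → rel b e ∈ T
  singular⇒absorb (_ , singular) {b} {c} {d} {e} cb≡cd de∈T =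
    singular zero (rel c d) (rel d e) valency-zero de∈T (rel b e)
      (·-intro (·-intro (·-intro (rel-refl b) (trans (transpose c b) (cong _* cb≡cd))) refl) refl)

  *·⊆Oup : ∀ {y b c d} → rel b c ≡ y * → rel c d ≡ y → Oup S (rel b d)
  *·⊆Oup {y} {b} {c} {d} bc≡y* cd≡y U (U-closed , U-normal) =
    U-normal y (rel b d) (·-intro (·-intro bc≡y* (rel-refl∈closed U-closed c)) cd≡y)

  singular⇐ : ∀ {T} → Closed S T → (∀ k → Oup S k ⊎ Othin S k → k ∈ T) → Singular S T
  singular⇐ {T} closed ⊇O = (λ k → ⊇O k ∘ inj₂) , absorbs
    where
      absorbs : ∀ x y z → Othin S x → z ∈ T →
        _⊆ₚ_ S (_·_ S (_·_ S (_·_ S (｛_｝ S x) (｛_｝ S (y *))) (｛_｝ S y)) (｛_｝ S z)) (⟦_⟧ S T)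
      absorbs x y z x-thin z∈T k k∈ with a , e , refl ← nonempty k
        with c′ , k∈′ , refl ← ·-elim k∈
        with c , k∈″ , cc′≡y ← ·-elim k∈′
        with b , refl , bc≡y* ← ·-elim k∈″ =
        closed-trans closed
          (closed-trans closed (⊇O _ (inj₂ x-thin)) (⊇O _ (inj₁ (*·⊆Oup bc≡y* cc′≡y))))
          z∈T

proposition3p5 : {n d : ℕ} (S : Scheme n d) (T : Subset (suc d)) →
    Closed S T →
    Singular S T ⇔ (∀ k → Oup S k ⊎ Othin S k → k ∈ T)
proposition3p5 S T closed = mk⇔ ⊇O (singular⇐ S closed)
  where
    ⊇O : Singular S T → ∀ k → Oup S k ⊎ Othin S k → k ∈ T
    ⊇O singular k (inj₁ k∈Oup) = core⊆T (k∈Oup core core-stronglyNormalClosed)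
      where open StronglyNormalCore S closed (singular⇒absorb S singular)
    ⊇O singular k (inj₂ k-thin) = proj₁ singular k k-thin
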